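{- Let $D$ be a minimal strong digraph, let $C_q$ be a directed cycle of length $q\ge 2$ contained in $D$, and let $D'$ be the digraph obtained from $D$ by deleting all arcs of $C_q$ (keeping all vertices). Then every non-trivial strong component $S$ of $D'$ that contains at most one vertex of $C_q$ contains at least one vertex which is a linear vertex of $D$.
   Context: A digraph is strongly connected (strong) if every vertex can reach every other by a directed path. An arc $uv$ of a digraph is transitive if there is another directed $uv$-path not using the arc $uv$. A minimal strong digraph (MSD) is a strongly connected digraph with no transitive arcs (equivalently, deleting any arc destroys strong connectivity). A strong component (SC) is a maximal strongly connected subdigraph; it is trivial if it has only one vertex. A vertex $v$ of $D$ is linear if its indegree and outdegree in $D$ are both equal to $1$. All cycles and paths are directed. -}

module Defs where

open import Data.Nat using (ℕ; suc)
open import Data.Fin using (Fin; zero; suc; inject₁; fromℕ)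
open import Data.Fin.Subset using (Subset; _∈_; _⊆_; ∣_∣)
open import Data.Vec using (tabulate)
open import Data.Sum using (_⊎_)
open import Data.Bool using (Bool; true; false)
open import Data.Product using (Σ; ∃; _×_; _,_)
open import Relation.Nullary using (¬_)
open import Relation.Binary.PropositionalEquality using (_≡_; _≢_)

Digraph : ℕ → Set
Digraph n = Fin n → Fin n → Bool

Arc : ∀ {n} → Digraph n → Fin n → Fin n → Set
Arc D u v = D u v ≡ true

Loopless : ∀ {n} → Digraph n → Set
Loopless D = ∀ v → D v v ≡ false

-- Arc relations (possibly not given by a Bool matrix, e.g. after deleting arcs).
ArcRel : ℕ → Set₁
ArcRel n = Fin n → Fin n → Set

data Reach {n} (R : ArcRel n) : Fin n → Fin n → Set where
  here  : ∀ {u} → Reach R u u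
  there : ∀ {u w v} → R u w → Reach R w v → Reach R u v

Strong : ∀ {n} → ArcRel n → Set
Strong R = ∀ u v → Reach R u v

deleteArc : ∀ {n} → Digraph n → Fin n → Fin n → ArcRel n
deleteArc D u v x y = Arc D x y × ¬ (x ≡ u × y ≡ v)

Transitive : ∀ {n} → Digraph n → Fin n → Fin n → Set
Transitive D u v = Arc D u v × Reach (deleteArc D u v) u v

MSD : ∀ {n} → Digraph n → Set
MSD D = Strong (Arc D) × (∀ u v → ¬ Transitive D u v)

-- A directed cycle of length q = suc (suc k) ≥ 2 in D: distinct vertices
-- c 0, …, c (q-1) with arcs c i → c (i+1) and c (q-1) → c 0.
record Cycle {n} (D : Digraph n) (k : ℕ) : Set where
  field
    vtx      : Fin (suc (suc k)) → Fin n
    distinct : ∀ i j → vtx i ≡ vtx j → i ≡ j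
    arcs     : ∀ (i : Fin (suc k)) → Arc D (vtx (inject₁ i)) (vtx (suc i))
    closing  : Arc D (vtx (fromℕ (suc k))) (vtx zero)
open Cycle public

CycleArc : ∀ {n} {D : Digraph n} {k} → Cycle D k → Fin n → Fin n → Set
CycleArc {k = k} C x y =
  (Σ (Fin (suc k)) λ i → x ≡ vtx C (inject₁ i) × y ≡ vtx C (suc i))
  ⊎ (x ≡ vtx C (fromℕ (suc k)) × y ≡ vtx C zero)

deleteCycle : ∀ {n} {D : Digraph n} {k} → Cycle D k → ArcRel n
deleteCycle {D = D} C x y = Arc D x y × ¬ CycleArc C x y

-- Walk from u to v inside the subdigraph induced by S (u assumed in S).
data ReachIn {n} (R : ArcRel n) (S : Subset n) : Fin n → Fin n → Set where
  here  : ∀ {u} → ReachIn R S u u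
  there : ∀ {u w v} → R u w → w ∈ S → ReachIn R S w v → ReachIn R S u v

StrongOn : ∀ {n} → ArcRel n → Subset n → Set
StrongOn R S = ∀ u v → u ∈ S → v ∈ S → ReachIn R S u v

StrongComponent : ∀ {n} → ArcRel n → Subset n → Set
StrongComponent R S =
  (∃ λ v → v ∈ S) × StrongOn R S × (∀ T → S ⊆ T → StrongOn R T → T ⊆ S)

NonTrivial : ∀ {n} → Subset n → Set
NonTrivial S = Σ _ λ u → Σ _ λ v → u ∈ S × v ∈ S × u ≢ v

outdeg indeg : ∀ {n} → Digraph n → Fin n → ℕ
outdeg D v = ∣ tabulate (λ w → D v w) ∣
indeg  D v = ∣ tabulate (λ u → D u v) ∣

Linear : ∀ {n} → Digraph n → Fin n → Set
Linear D v = indeg D v ≡ 1 × outdeg D v ≡ 1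

{-# OPTIONS --safe #-}
module Submission where

-- Suppose no vertex of S is linear in D. Call K admissible if it contains the cycle, induces a
-- strong subdigraph of D and misses some vertex of S; the vertex set of the cycle is admissible,
-- and well-founded induction on ⊃ lets us assume K is ⊂-maximal. Adding an ear of D to K keeps
-- it strong, so by maximality every ear through a new vertex covers S.
-- If S is disjoint from K, an ear entering S at s₁ contains all of S, and the last arc z → s₁
-- of a path inside S is transitive. Otherwise S has a D′-arc u → p leaving K; continue it inside
-- S back to K. That ear covers S, and since D has no transitive arcs, u is the only
-- in-neighbour and the next vertex y the only out-neighbour of p: so p is linear.

open import Defs
open import Data.Nat using (ℕ)
import Data.Nat as ℕ
open import Data.Fin using (Fin; zero; suc; inject₁; fromℕ; _≟_)
open import Data.Fin.Subset using (Subset; _∈_; _∉_; _⊆_; _⊂_; _∪_; ⁅_⁆; ∣_∣)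
open import Data.Fin.Subset.Properties
  using (_∈?_; x∈⁅x⁆; x∈⁅y⁆⇒x≡y; x∈p∪q⁺; x∈p∪q⁻; p⊆p∪q; q⊆p∪q; ∣⁅x⁆∣≡1; ⊆-antisym)
open import Data.Fin.Subset.Induction using (⊃-wellFounded)
open import Data.Fin.Properties using (any?)
open import Data.Vec using (tabulate)
open import Data.Vec.Properties using (lookup∘tabulate; []=⇒lookup; lookup⇒[]=)
open import Data.Bool using (Bool; true)
open import Data.Product using (Σ; ∃-syntax; _×_; _,_; proj₁; proj₂)
open import Data.Sum using (_⊎_; inj₁; inj₂; [_,_]; map₁)
open import Data.Empty using (⊥; ⊥-elim)
open import Function using (_∘_)
open import Level using (0ℓ)
open import Induction.WellFounded using (module All)
open import Relation.Nullary using (¬_; yes; no)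
open import Relation.Nullary.Decidable using (_×-dec_; _⊎-dec_; decidable-stable)
open import Relation.Unary using (Pred; Decidable; ∁)
open import Relation.Binary.PropositionalEquality using (_≡_; _≢_; refl; sym; trans; subst; cong)

private variable
  m n : ℕ
  R R′ : ArcRel n
  P : Pred (Fin n) 0ℓ
  T U : Subset n
  a b c d p t u v w x y z : Fin n

infixr 5 _++_

_++_ : Reach R x y → Reach R y z → Reach R x z
here      ++ q = q
there r p ++ q = there r (p ++ q)

map : (∀ {c d} → R c d → R′ c d) → Reach R x y → Reach R′ x y
map f here        = here
map f (there r p) = there (f r) (map f p)

Into From : ArcRel n → Pred (Fin n) 0ℓ → ArcRel n
Into R P c d = R c d × P d
From R P c d = R c d × P c

ReachIn⇒Reach : ReachIn R T x y → Reach (Into R (_∈ T)) x y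
ReachIn⇒Reach here           = here
ReachIn⇒Reach (there r wT p) = there (r , wT) (ReachIn⇒Reach p)

Reach⇒ReachIn : Reach (Into R (_∈ T)) x y → ReachIn R T x y
Reach⇒ReachIn here                = here
Reach⇒ReachIn (there (r , wT) p) = there r wT (Reach⇒ReachIn p)

Into-end : P x → Reach (Into R P) x y → P y
Into-end px here               = px
Into-end _  (there (_ , pw) p) = Into-end pw p

Into∁⇒From∁ : ¬ P x → Reach (Into R (∁ P)) x y → Reach (From R (∁ P)) x y
Into∁⇒From∁ _   here                 = here
Into∁⇒From∁ ¬px (there (r , ¬pw) p) = there (r , ¬px) (Into∁⇒From∁ ¬pw p)

vertices : {R : ArcRel n} {x y : Fin n} → Reach R x y → Subset n
vertices {x = x} here        = ⁅ x ⁆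
vertices {x = x} (there _ p) = ⁅ x ⁆ ∪ vertices p

start∈ : (p : Reach R x y) → x ∈ vertices p
start∈ {x = x} here        = x∈⁅x⁆ x
start∈ {x = x} (there _ p) = x∈p∪q⁺ (inj₁ (x∈⁅x⁆ x))

∈-there⁺ : (r : R x w) (p : Reach R w y) → v ∈ vertices p → v ∈ vertices (there r p)
∈-there⁺ _ _ v∈p = x∈p∪q⁺ (inj₂ v∈p)

∈-there⁻ : (r : R x w) (p : Reach R w y) → v ∈ vertices (there r p) → v ≡ x ⊎ v ∈ vertices p
∈-there⁻ {x = x} _ p v∈ with x∈p∪q⁻ ⁅ x ⁆ (vertices p) v∈
... | inj₁ v∈x = inj₁ (x∈⁅y⁆⇒x≡y x v∈x)
... | inj₂ v∈p = inj₂ v∈p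

end∈ : (p : Reach R x y) → y ∈ vertices p
end∈ {y = y} here = x∈⁅x⁆ y
end∈ (there r p) = ∈-there⁺ r p (end∈ p)

∈-++ʳ : (p : Reach R x y) (q : Reach R y z) → v ∈ vertices q → v ∈ vertices (p ++ q)
∈-++ʳ here        q v∈q = v∈q
∈-++ʳ (there r p) q v∈q = ∈-there⁺ r (p ++ q) (∈-++ʳ p q v∈q)

∈-++⁻ : (p : Reach R x y) (q : Reach R y z) → v ∈ vertices (p ++ q) → v ∈ vertices p ⊎ v ∈ vertices q
∈-++⁻ here        q v∈ = inj₂ v∈
∈-++⁻ (there r p) q v∈ with ∈-there⁻ r (p ++ q) v∈
... | inj₁ refl = inj₁ (start∈ (there r p))
... | inj₂ v∈′  = map₁ (∈-there⁺ r p) (∈-++⁻ p q v∈′)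

vertices-map : (f : ∀ {c d} → R c d → R′ c d) (p : Reach R x y) → vertices (map f p) ≡ vertices p
vertices-map f here                = refl
vertices-map {x = x} f (there r p) = cong (⁅ x ⁆ ∪_) (vertices-map f p)

∈-map⁻ : (f : ∀ {c d} → R c d → R′ c d) (p : Reach R x y) → v ∈ vertices (map f p) → v ∈ vertices p
∈-map⁻ f p = subst (_ ∈_) (vertices-map f p)

split : (p : Reach R x y) → v ∈ vertices p → Reach R x v × Reach R v y
split here v∈ with x∈⁅y⁆⇒x≡y _ v∈
... | refl = here , here
split (there r p) v∈ with ∈-there⁻ r p v∈
... | inj₁ refl = here , there r p
... | inj₂ v∈p  = let (pre , post) = split p v∈p in there r pre , post

within : (p : Reach R x y) → Reach (Into R (_∈ vertices p)) x y
within here        = here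
within (there r p) =
  there (r , ∈-there⁺ r p (start∈ p)) (map (λ (r′ , w∈) → r′ , ∈-there⁺ r p w∈) (within p))

vertices-within : (p : Reach R x y) → vertices (within p) ≡ vertices p
vertices-within here                = refl
vertices-within {x = x} (there r p) =
  cong (⁅ x ⁆ ∪_) (trans (vertices-map _ (within p)) (vertices-within p))

splitWithin : (p : Reach R x y) → v ∈ vertices p →
              Reach (Into R (_∈ vertices p)) x v × Reach (Into R (_∈ vertices p)) v y
splitWithin p v∈ = split (within p) (subst (_ ∈_) (sym (vertices-within p)) v∈)

meets-only-at-end : (∀ {c d} → R c d → ¬ P c) → (p : Reach R x y) → v ∈ vertices p → P v → v ≡ y
meets-only-at-end _   here        v∈ _  = x∈⁅y⁆⇒x≡y _ v∈
meets-only-at-end src (there r p) v∈ pv with ∈-there⁻ r p v∈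
... | inj₁ refl = ⊥-elim (src r pv)
... | inj₂ v∈p  = meets-only-at-end src p v∈p pv

meets-only-at-start : (∀ {c d} → R c d → ¬ P d) → (p : Reach R x y) → v ∈ vertices p → P v → v ≡ x
meets-only-at-start _   here        v∈ _  = x∈⁅y⁆⇒x≡y _ v∈
meets-only-at-start tgt (there r p) v∈ pv with ∈-there⁻ r p v∈
... | inj₁ v≡x = v≡x
... | inj₂ v∈p with meets-only-at-start tgt p v∈p pv
...   | refl = ⊥-elim (tgt r pv)

firstHit : Decidable P → Reach R x y → P y → ∃[ q ] P q × Reach (From R (∁ P)) x q
firstHit {x = x} P? here        py = x , py , here
firstHit {x = x} P? (there r p) py with P? x
... | yes px  = x , px , here
... | no  ¬px = let (q , pq , p′) = firstHit P? p py in q , pq , there (r , ¬px) p′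

avoidOrLastVisit : Decidable P → Reach R x y →
                   Reach (Into R (∁ P)) x y ⊎ (∃[ q ] P q × Reach R x q × Reach (Into R (∁ P)) q y)
avoidOrLastVisit P? here = inj₁ here
avoidOrLastVisit P? (there {w = w} r p) with avoidOrLastVisit P? p | P? w
... | inj₂ (q , pq , pre , post) | _       = inj₂ (q , pq , there r pre , post)
... | inj₁ p′                    | yes pw  = inj₂ (w , pw , there r here , p′)
... | inj₁ p′                    | no  ¬pw = inj₁ (there (r , ¬pw) p′)

lastVisit : Decidable P → P x → Reach R x y → ∃[ q ] P q × Reach R x q × Reach (Into R (∁ P)) q y
lastVisit P? px p with avoidOrLastVisit P? p
... | inj₁ p′    = _ , px , here , p′
... | inj₂ visit = visit

withoutReturn : Reach R x y → Reach (Into R (_≢ x)) x y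
withoutReturn {x = x} p with lastVisit (_≟ x) refl p
... | _ , refl , _ , p′ = p′

lastArc : x ∈ T → ReachIn R T x y → x ≡ y ⊎ ∃[ z ] z ∈ T × R z y
lastArc _  here           = inj₁ refl
lastArc xT (there r wT p) with lastArc wT p
... | inj₁ refl  = inj₂ (_ , xT , r)
... | inj₂ found = inj₂ found

StrongOn-∪-ear : StrongOn R T → a ∈ T → b ∈ T → (E : Reach R a b) → StrongOn R (T ∪ vertices E)
StrongOn-∪-ear {R = R} {T = T} {a = a} {b = b} strong aT bT E u v uG vG =
  Reach⇒ReachIn (toA u uG ++ fromA v vG)
  where
  G = T ∪ vertices E

  liftT : ∀ {x y} → ReachIn R T x y → Reach (Into R (_∈ G)) x y
  liftT p = map (λ (r , w∈) → r , p⊆p∪q (vertices E) w∈) (ReachIn⇒Reach p)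

  liftE : ∀ {x y} → Reach (Into R (_∈ vertices E)) x y → Reach (Into R (_∈ G)) x y
  liftE = map (λ (r , w∈) → r , q⊆p∪q T (vertices E) w∈)

  toA : ∀ x → x ∈ G → Reach (Into R (_∈ G)) x a
  toA x x∈ with x∈p∪q⁻ T (vertices E) x∈
  ... | inj₁ xT = liftT (strong x a xT aT)
  ... | inj₂ xE = liftE (proj₂ (splitWithin E xE)) ++ liftT (strong b a bT aT)

  fromA : ∀ y → y ∈ G → Reach (Into R (_∈ G)) a y
  fromA y y∈ with x∈p∪q⁻ T (vertices E) y∈
  ... | inj₁ yT = liftT (strong a y aT yT)
  ... | inj₂ yE = liftE (proj₁ (splitWithin E yE))

StrongOn-⁅⁆ : StrongOn R ⁅ x ⁆
StrongOn-⁅⁆ {x = x} u v u∈ v∈ with x∈⁅y⁆⇒x≡y x u∈ | x∈⁅y⁆⇒x≡y x v∈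
... | refl | refl = here

StrongComponent-convex : StrongComponent R T → x ∈ T → y ∈ T → Reach R x z → Reach R z y → z ∈ T
StrongComponent-convex {T = T} (_ , strong , maximal) xT yT p q =
  maximal (T ∪ vertices (p ++ q)) (p⊆p∪q (vertices (p ++ q)))
          (StrongOn-∪-ear strong xT yT (p ++ q)) (x∈p∪q⁺ (inj₂ (∈-++ʳ p q (start∈ q))))

NonTrivial-escape : NonTrivial T → (∀ {u v} → u ∈ T → v ∈ T → u ∈ U → v ∈ U → u ≡ v) →
                    ∃[ s ] s ∈ T × s ∉ U
NonTrivial-escape {U = U} (u , v , uT , vT , u≢v) subsingleton with u ∈? U | v ∈? U
... | no  u∉ | _      = u , uT , u∉
... | yes _  | no  v∉ = v , vT , v∉
... | yes u∈ | yes v∈ = ⊥-elim (u≢v (subsingleton uT vT u∈ v∈))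

NonTrivial⇒other : NonTrivial T → ∀ v → ∃[ x ] x ∈ T × x ≢ v
NonTrivial⇒other (x , y , xT , yT , x≢y) v with x ≟ v
... | yes refl = y , yT , x≢y ∘ sym
... | no  x≢v  = x , xT , x≢v

module Deletion {n} (D : Digraph n) where

  deleteArc-source : Arc D x y → x ≢ c → deleteArc D c d x y
  deleteArc-source r x≢c = r , λ (x≡c , _) → x≢c x≡c

  deleteArc-target : Arc D x y → y ≢ d → deleteArc D c d x y
  deleteArc-target r y≢d = r , λ (_ , y≡d) → y≢d y≡d

  StrongOn-avoids : StrongOn (Arc D) T → x ∈ T → y ∈ T → c ∉ T ⊎ d ∉ T → Reach (deleteArc D c d) x y
  StrongOn-avoids {T = T} {c = c} {d = d} strong xT yT outside = go xT (strong _ _ xT yT)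
    where
    go : ∀ {x y} → x ∈ T → ReachIn (Arc D) T x y → Reach (deleteArc D c d) x y
    go _  here           = here
    go xT (there r wT p) =
      there (r , λ (x≡c , w≡d) → [ (λ c∉ → c∉ (subst (_∈ T) x≡c xT))
                                 , (λ d∉ → d∉ (subst (_∈ T) w≡d wT)) ] outside)
          (go wT p)

∈-tabulate⁻ : (f : Fin m → Bool) → x ∈ tabulate f → f x ≡ true
∈-tabulate⁻ f x∈ = trans (sym (lookup∘tabulate f _)) ([]=⇒lookup x∈)

∈-tabulate⁺ : (f : Fin m → Bool) → f x ≡ true → x ∈ tabulate f
∈-tabulate⁺ f fx = lookup⇒[]= _ (tabulate f) (trans (lookup∘tabulate f _) fx)

∣tabulate∣≡1 : (f : Fin m → Bool) → f a ≡ true → (∀ b → f b ≡ true → b ≡ a) → ∣ tabulate f ∣ ≡ 1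
∣tabulate∣≡1 {a = a} f fa unique = trans (cong ∣_∣ tabulate≡⁅a⁆) (∣⁅x⁆∣≡1 a)
  where
  tabulate≡⁅a⁆ : tabulate f ≡ ⁅ a ⁆
  tabulate≡⁅a⁆ = ⊆-antisym
    (λ x∈ → subst (_∈ ⁅ a ⁆) (sym (unique _ (∈-tabulate⁻ f x∈))) (x∈⁅x⁆ a))
    (λ x∈ → subst (_∈ tabulate f) (sym (x∈⁅y⁆⇒x≡y a x∈)) (∈-tabulate⁺ f fa))

linear? : (D : Digraph n) → Decidable (Linear D)
linear? D v = (indeg D v ℕ.≟ 1) ×-dec (outdeg D v ℕ.≟ 1)

walkAlong : (f : Fin (ℕ.suc m) → Fin n) → (∀ i → R (f (inject₁ i)) (f (suc i))) →
            R (f (fromℕ m)) t → Reach R (f zero) t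
walkAlong {m = ℕ.zero}  f step last = there last here
walkAlong {m = ℕ.suc m} f step last = there (step zero) (walkAlong (f ∘ suc) (step ∘ suc) last)

∈-walkAlong⁺ : (f : Fin (ℕ.suc m) → Fin n) (step : ∀ i → R (f (inject₁ i)) (f (suc i)))
               (last : R (f (fromℕ m)) t) → ∀ j → f j ∈ vertices (walkAlong {R = R} f step last)
∈-walkAlong⁺ f step last zero = start∈ (walkAlong f step last)
∈-walkAlong⁺ {m = ℕ.zero}  f step last (suc ())
∈-walkAlong⁺ {m = ℕ.suc m} f step last (suc j) =
  ∈-there⁺ (step zero) (walkAlong (f ∘ suc) (step ∘ suc) last)
           (∈-walkAlong⁺ (f ∘ suc) (step ∘ suc) last j)

∈-walkAlong⁻ : (f : Fin (ℕ.suc m) → Fin n) (step : ∀ i → R (f (inject₁ i)) (f (suc i)))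
               (last : R (f (fromℕ m)) t) → v ∈ vertices (walkAlong {R = R} f step last) →
               (∃[ j ] f j ≡ v) ⊎ v ≡ t
∈-walkAlong⁻ {m = ℕ.zero} {R = R} f step last v∈ with ∈-there⁻ last (here {R = R}) v∈
... | inj₁ refl = inj₁ (zero , refl)
... | inj₂ v∈t  = inj₂ (x∈⁅y⁆⇒x≡y _ v∈t)
∈-walkAlong⁻ {m = ℕ.suc m} f step last v∈
  with ∈-there⁻ (step zero) (walkAlong (f ∘ suc) (step ∘ suc) last) v∈
... | inj₁ refl = inj₁ (zero , refl)
... | inj₂ v∈′  = map₁ (λ (j , fj≡v) → suc j , fj≡v) (∈-walkAlong⁻ (f ∘ suc) (step ∘ suc) last v∈′)

module Argument
  {n} (D : Digraph n) (loopless : Loopless D) (msd : MSD D)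
  {k} (C : Cycle D k) (S : Subset n) (component : StrongComponent (deleteCycle C) S)
  (nontrivial : NonTrivial S) (atMostOne : ∀ i j → vtx C i ∈ S → vtx C j ∈ S → i ≡ j)
  (noLinear : ∀ v → v ∈ S → ¬ Linear D v)
  where

  open Deletion D

  A D′ : ArcRel n
  A  = Arc D
  D′ = deleteCycle C

  reach : ∀ x y → Reach A x y
  reach = proj₁ msd

  strongS : StrongOn D′ S
  strongS = proj₁ (proj₂ component)

  reachS : x ∈ S → y ∈ S → Reach (Into D′ (_∈ S)) x y
  reachS xS yS = ReachIn⇒Reach (strongS _ _ xS yS)

  notTransitive : A x y → ¬ Reach (deleteArc D x y) x y
  notTransitive r p = proj₂ msd _ _ (r , p)

  arc⇒≢ : A x y → x ≢ y
  arc⇒≢ {x = x} r refl with trans (sym r) (loopless x)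
  ... | ()

  cycleArc⇒∈ : (∀ i → vtx C i ∈ T) → CycleArc C x y → x ∈ T × y ∈ T
  cycleArc⇒∈ cycle⊆ (inj₁ (i , refl , refl)) = cycle⊆ (inject₁ i) , cycle⊆ (suc i)
  cycleArc⇒∈ cycle⊆ (inj₂ (refl , refl))     = cycle⊆ (fromℕ (ℕ.suc k)) , cycle⊆ zero

  D′-arc : (∀ i → vtx C i ∈ T) → A x y → x ∉ T ⊎ y ∉ T → D′ x y
  D′-arc cycle⊆ r outside = r , λ cycleArc →
    let (xT , yT) = cycleArc⇒∈ cycle⊆ cycleArc in [ (λ x∉ → x∉ xT) , (λ y∉ → y∉ yT) ] outside

  convex : x ∈ S → y ∈ S → Reach D′ x z → Reach D′ z y → z ∈ S
  convex = StrongComponent-convex component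

  record Admissible (K : Subset n) : Set where
    field
      cycle⊆ : ∀ i → vtx C i ∈ K
      strong : StrongOn A K
      escape : ∃[ s ] s ∈ S × s ∉ K

  Saturated : Subset n → Set
  Saturated K = ∀ {K′} → K ⊂ K′ → ¬ Admissible K′

  module _ {K : Subset n} (admissible : Admissible K) (saturated : Saturated K) where
    open Admissible admissible

    escaping-ear⇒⊥ : (E : Reach A a b) → a ∈ K → b ∈ K → x ∈ vertices E → x ∉ K →
                     v ∈ S → v ∉ K ∪ vertices E → ⊥
    escaping-ear⇒⊥ E aK bK xE x∉K vS v∉ =
      saturated (p⊆p∪q (vertices E) , _ , q⊆p∪q K (vertices E) xE , x∉K) record
        { cycle⊆ = p⊆p∪q (vertices E) ∘ cycle⊆
        ; strong = StrongOn-∪-ear strong aK bK E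
        ; escape = _ , vS , v∉
        }

    ear-covers : (E : Reach A a b) → a ∈ K → b ∈ K → x ∈ vertices E → x ∉ K → S ⊆ K ∪ vertices E
    ear-covers E aK bK xE x∉K vS =
      decidable-stable (_ ∈? (K ∪ vertices E)) (escaping-ear⇒⊥ E aK bK xE x∉K vS)

    module Crossing {a s₁ s₂ : Fin n}
      (disjoint : ∀ {v} → v ∈ S → v ∉ K) (aK : a ∈ K) (s₁S : s₁ ∈ S)
      (W₁ : Reach (From A (_∉ S)) a s₁)
      (M : Reach (Into (Into D′ (_∈ S)) (_≢ s₁)) s₁ s₂)
      (W₂ : Reach (Into A (_∉ S)) s₂ a)
      where

      M-arc : ∀ {c d} → Into (Into D′ (_∈ S)) (_≢ s₁) c d → A c d
      M-arc (((r , _) , _) , _) = r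

      E : Reach A a a
      E = map proj₁ W₁ ++ map M-arc M ++ map proj₁ W₂

      covers : S ⊆ K ∪ vertices E
      covers = ear-covers E aK aK (∈-++ʳ (map proj₁ W₁) _ (start∈ (map M-arc M ++ map proj₁ W₂)))
                          (disjoint s₁S)

      E∩S⊆M : z ∈ S → z ∈ vertices E → z ∈ vertices M
      E∩S⊆M zS zE with ∈-++⁻ (map proj₁ W₁) _ zE
      ... | inj₁ zW₁ = subst (_∈ vertices M)
                             (sym (meets-only-at-end proj₂ W₁ (∈-map⁻ proj₁ W₁ zW₁) zS)) (start∈ M)
      ... | inj₂ zMW₂ with ∈-++⁻ (map M-arc M) (map proj₁ W₂) zMW₂
      ...   | inj₁ zM  = ∈-map⁻ M-arc M zM
      ...   | inj₂ zW₂ = subst (_∈ vertices M)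
                               (sym (meets-only-at-start proj₂ W₂ (∈-map⁻ proj₁ W₂ zW₂) zS)) (end∈ M)

      S⊆M : z ∈ S → z ∈ vertices M
      S⊆M zS = [ (λ zK → ⊥-elim (disjoint zS zK)) , E∩S⊆M zS ] (x∈p∪q⁻ K (vertices E) (covers zS))

      -- S has an arc z → s₁; since S lies on M, closing M through W₂ and W₁ makes it transitive.
      contradiction : ⊥
      contradiction with NonTrivial⇒other nontrivial s₁
      ... | x , xS , x≢s₁ with lastArc xS (strongS x s₁ xS s₁S)
      ...   | inj₁ x≡s₁ = x≢s₁ x≡s₁
      ...   | inj₂ (z , zS , (zs₁ , _)) =
        notTransitive zs₁ (map avoidM (proj₂ (split M (S⊆M zS))) ++ map avoidW₂ W₂ ++ map avoidW₁ W₁)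
        where
        avoidM : ∀ {c d} → Into (Into D′ (_∈ S)) (_≢ s₁) c d → deleteArc D z s₁ c d
        avoidM r = deleteArc-target (M-arc r) (proj₂ r)

        avoidW₂ : ∀ {c d} → Into A (_∉ S) c d → deleteArc D z s₁ c d
        avoidW₂ (r , d∉S) = deleteArc-target r (λ d≡s₁ → d∉S (subst (_∈ S) (sym d≡s₁) s₁S))

        avoidW₁ : ∀ {c d} → From A (_∉ S) c d → deleteArc D z s₁ c d
        avoidW₁ (r , c∉S) = deleteArc-source r (λ c≡z → c∉S (subst (_∈ S) (sym c≡z) zS))

    disjoint⇒⊥ : (∀ {v} → v ∈ S → v ∉ K) → ⊥
    disjoint⇒⊥ disjoint with escape
    ... | s , sS , _ with firstHit (_∈? S) (reach (vtx C zero) s) sS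
    ...   | s₁ , s₁S , W₁ with lastVisit (_∈? S) s₁S (reach s₁ (vtx C zero))
    ...     | s₂ , s₂S , _ , W₂ =
      Crossing.contradiction disjoint (cycle⊆ zero) s₁S W₁ (withoutReturn (reachS s₁S s₂S)) W₂

    ArcInS∖K : ArcRel n
    ArcInS∖K = From (Into D′ (_∈ S)) (_∉ K)

    module Exit {u p y b : Fin n}
      (uK : u ∈ K) (up : D′ u p) (pS : p ∈ S) (p∉K : p ∉ K) (bK : b ∈ K)
      (py : Into ArcInS∖K (_≢ p) p y) (Q : Reach (Into ArcInS∖K (_≢ p)) y b)
      where

      tail-arc : ∀ {c d} → ArcInS∖K c d → A c d
      tail-arc ((r , _) , _) = proj₁ r

      pyA : A p y
      pyA = tail-arc (proj₁ py)

      yS : y ∈ S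
      yS = proj₂ (proj₁ (proj₁ py))

      y≢p : y ≢ p
      y≢p = proj₂ py

      avoidIn : ∀ {c c′ d} → Into ArcInS∖K (_≢ p) c′ d → deleteArc D c p c′ d
      avoidIn (r , d≢p) = deleteArc-target (tail-arc r) d≢p

      avoidOut : ∀ {c c′ d} → From ArcInS∖K (_≢ p) c′ d → deleteArc D p c c′ d
      avoidOut (r , c′≢p) = deleteArc-source (tail-arc r) c′≢p

      tailE : Reach A p b
      tailE = there pyA (map (tail-arc ∘ proj₁) Q)

      E : Reach A u b
      E = there (proj₁ up) tailE

      covers : S ⊆ K ∪ vertices E
      covers = ear-covers E uK bK (∈-there⁺ (proj₁ up) tailE (start∈ tailE)) p∉K

      S∖K⊆Q : t ∈ S → t ∉ K → t ≢ p → t ∈ vertices Q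
      S∖K⊆Q tS t∉K t≢p with x∈p∪q⁻ K (vertices E) (covers tS)
      ... | inj₁ tK = ⊥-elim (t∉K tK)
      ... | inj₂ tE with ∈-there⁻ (proj₁ up) tailE tE
      ...   | inj₁ refl = ⊥-elim (t∉K uK)
      ...   | inj₂ tE′ with ∈-there⁻ pyA (map (tail-arc ∘ proj₁) Q) tE′
      ...     | inj₁ t≡p = ⊥-elim (t≢p t≡p)
      ...     | inj₂ tQ  = ∈-map⁻ (tail-arc ∘ proj₁) Q tQ

      K∪S : Pred (Fin n) 0ℓ
      K∪S t = t ∈ K ⊎ t ∈ S

      K∪S? : Decidable K∪S
      K∪S? t = (t ∈? K) ⊎-dec (t ∈? S)

      outside⇒≢p : ¬ K∪S t → t ≢ p
      outside⇒≢p t∉ t≡p = t∉ (inj₂ (subst (_∈ S) (sym t≡p) pS))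

      walkToU : K∪S t → t ≢ p → Reach (deleteArc D c p) t u
      walkToU (inj₁ tK) _ = StrongOn-avoids strong tK uK (inj₂ p∉K)
      walkToU {t = t} (inj₂ tS) t≢p with t ∈? K
      ... | yes tK  = walkToU (inj₁ tK) t≢p
      ... | no  t∉K = map avoidIn (proj₂ (split Q (S∖K⊆Q tS t∉K t≢p)))
                   ++ StrongOn-avoids strong bK uK (inj₂ p∉K)

      walkFromY : K∪S t → t ≢ p → Reach (deleteArc D p c) y t
      walkFromY (inj₁ tK) _ = map avoidOut (Into∁⇒From∁ {P = _≡ p} y≢p Q)
                           ++ StrongOn-avoids strong bK tK (inj₁ p∉K)
      walkFromY {t = t} (inj₂ tS) t≢p with t ∈? K
      ... | yes tK  = walkFromY (inj₁ tK) t≢p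
      ... | no  t∉K =
        map avoidOut (Into∁⇒From∁ {P = _≡ p} y≢p (proj₁ (split Q (S∖K⊆Q tS t∉K t≢p))))

      -- From K ∪ S, t reaches u without entering p, so t → p is transitive. Otherwise the last
      -- visit q to K ∪ S of a walk u ⋯ t lies in K (in S it would pull t into S), and then
      -- u ⋯ q ⋯ t → p makes u → p transitive.
      otherIn⇒⊥ : A t p → t ≢ u → ⊥
      otherIn⇒⊥ {t = t} tp t≢u with K∪S? t
      ... | yes tKS =
        notTransitive tp
          (walkToU tKS (arc⇒≢ tp) ++ there (deleteArc-source (proj₁ up) (t≢u ∘ sym)) here)
      ... | no t∉KS with lastVisit K∪S? (inj₁ uK) (reach u t)
      ...   | q , inj₂ qS , _ , W =
        t∉KS (inj₂ (convex qS pS (map (λ (r , d∉) → D′-arc cycle⊆ r (inj₂ (d∉ ∘ inj₁))) W)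
                                 (there (D′-arc cycle⊆ tp (inj₁ (t∉KS ∘ inj₁))) here)))
      ...   | q , inj₁ qK , _ , W =
        notTransitive (proj₁ up)
          (StrongOn-avoids strong uK qK (inj₂ p∉K)
           ++ map (λ (r , d∉) → deleteArc-target r (outside⇒≢p d∉)) W
           ++ there (deleteArc-source tp t≢u) here)

      -- Either p → y is transitive through t ⋯ q and K, or the ear u → p → t ⋯ q misses y ∈ S.
      detour⇒⊥ : ∀ {q} → A p t → t ≢ y → q ∈ K → Reach (From A (∁ K∪S)) t q → ⊥
      detour⇒⊥ {q = q} pt t≢y qK W with y ∈? K
      ... | yes yK =
        notTransitive pyA
          (there (deleteArc-target pt t≢y)
             (map (λ (r , c∉) → deleteArc-source r (outside⇒≢p c∉)) W
              ++ StrongOn-avoids strong qK yK (inj₁ p∉K)))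
      ... | no y∉K =
        escaping-ear⇒⊥ E₂ uK qK (∈-there⁺ (proj₁ up) tailE₂ (start∈ tailE₂)) p∉K yS y∉E₂
        where
        tailE₂ : Reach A p q
        tailE₂ = there pt (map proj₁ W)

        E₂ : Reach A u q
        E₂ = there (proj₁ up) tailE₂

        y∉E₂ : y ∉ K ∪ vertices E₂
        y∉E₂ y∈ with x∈p∪q⁻ K (vertices E₂) y∈
        ... | inj₁ yK = y∉K yK
        ... | inj₂ yE with ∈-there⁻ (proj₁ up) tailE₂ yE
        ...   | inj₁ refl = y∉K uK
        ...   | inj₂ yE′ with ∈-there⁻ pt (map proj₁ W) yE′
        ...     | inj₁ y≡p = y≢p y≡p
        ...     | inj₂ yW
          with meets-only-at-end (λ (_ , c∉) cS → c∉ (inj₂ cS)) W (∈-map⁻ proj₁ W yW) yS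
        ...       | refl = y∉K qK

      otherOut⇒⊥ : A p t → t ≢ y → ⊥
      otherOut⇒⊥ {t = t} pt t≢y with K∪S? t
      ... | yes tKS =
        notTransitive pt (there (deleteArc-target pyA (t≢y ∘ sym)) (walkFromY tKS (arc⇒≢ pt ∘ sym)))
      ... | no t∉KS with firstHit K∪S? (reach t u) (inj₁ uK)
      ...   | q , inj₂ qS , W =
        t∉KS (inj₂ (convex pS qS (there (D′-arc cycle⊆ pt (inj₂ (t∉KS ∘ inj₁))) here)
                                 (map (λ (r , c∉) → D′-arc cycle⊆ r (inj₁ (c∉ ∘ inj₁))) W)))
      ...   | q , inj₁ qK , W = detour⇒⊥ pt t≢y qK W

      p-linear : Linear D p
      p-linear =
          ∣tabulate∣≡1 (λ t → D t p) (proj₁ up) (λ t tp → decidable-stable (t ≟ u) (otherIn⇒⊥ tp))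
        , ∣tabulate∣≡1 (D p) pyA (λ t pt → decidable-stable (t ≟ y) (otherOut⇒⊥ pt))

    exit⇒⊥ : u ∈ S → u ∈ K → D′ u p → p ∈ S → p ∉ K → ⊥
    exit⇒⊥ uS uK up pS p∉K with firstHit (_∈? K) (reachS pS uS) uK
    ... | b , bK , Q₀ with withoutReturn Q₀
    ...   | here       = p∉K bK
    ...   | there py Q = noLinear _ pS (Exit.p-linear uK up pS p∉K bK py Q)

    meets⇒⊥ : u ∈ S → u ∈ K → ⊥
    meets⇒⊥ u₀S u₀K with escape
    ... | s , sS , s∉K with lastVisit (_∈? K) u₀K (reachS u₀S sS)
    ...   | _ , uK , _   , here                      = s∉K uK
    ...   | _ , uK , pre , there ((up , pS) , p∉K) _ = exit⇒⊥ (Into-end u₀S pre) uK up pS p∉K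

    saturated⇒⊥ : ⊥
    saturated⇒⊥ with any? (λ v → (v ∈? S) ×-dec (v ∈? K))
    ... | yes (_ , uS , uK) = meets⇒⊥ uS uK
    ... | no  none          = disjoint⇒⊥ (λ vS vK → none (_ , vS , vK))

  ¬Admissible : ∀ K → ¬ Admissible K
  ¬Admissible = All.wfRec ⊃-wellFounded 0ℓ (¬_ ∘ Admissible)
                          (λ _ saturated admissible → saturated⇒⊥ admissible saturated)

  c₀ : Fin n
  c₀ = vtx C zero

  around : Reach A c₀ c₀
  around = walkAlong (vtx C) (arcs C) (closing C)

  K₀ : Subset n
  K₀ = ⁅ c₀ ⁆ ∪ vertices around

  K₀-onCycle : v ∈ K₀ → ∃[ i ] vtx C i ≡ v
  K₀-onCycle v∈ with x∈p∪q⁻ ⁅ c₀ ⁆ (vertices around) v∈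
  ... | inj₁ v∈c₀ = zero , sym (x∈⁅y⁆⇒x≡y c₀ v∈c₀)
  ... | inj₂ v∈around with ∈-walkAlong⁻ (vtx C) (arcs C) (closing C) v∈around
  ...   | inj₁ onCycle = onCycle
  ...   | inj₂ v≡c₀    = zero , sym v≡c₀

  K₀∩S-subsingleton : u ∈ S → v ∈ S → u ∈ K₀ → v ∈ K₀ → u ≡ v
  K₀∩S-subsingleton uS vS u∈ v∈ with K₀-onCycle u∈ | K₀-onCycle v∈
  ... | i , refl | j , refl = cong (vtx C) (atMostOne i j uS vS)

  K₀-admissible : Admissible K₀
  K₀-admissible = record
    { cycle⊆ = q⊆p∪q ⁅ c₀ ⁆ (vertices around) ∘ ∈-walkAlong⁺ (vtx C) (arcs C) (closing C)
    ; strong = StrongOn-∪-ear StrongOn-⁅⁆ (x∈⁅x⁆ c₀) (x∈⁅x⁆ c₀) around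
    ; escape = NonTrivial-escape nontrivial K₀∩S-subsingleton
    }

  impossible : ⊥
  impossible = ¬Admissible K₀ K₀-admissible

theorem1 : ∀ {n} (D : Digraph n) → Loopless D → MSD D →
    ∀ {k} (C : Cycle D k) (S : Subset n) →
    StrongComponent (deleteCycle C) S → NonTrivial S →
    (∀ i j → vtx C i ∈ S → vtx C j ∈ S → i ≡ j) →
    Σ (Fin n) λ v → v ∈ S × Linear D v
theorem1 D loopless msd C S component nontrivial atMostOne
  with any? (λ v → (v ∈? S) ×-dec linear? D v)
... | yes found = found
... | no  none  = ⊥-elim (Argument.impossible D loopless msd C S component nontrivial atMostOne
                                               (λ v vS linear → none (v , vS , linear)))
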